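{- Let $s\ge1$, let $n_1,\dots,n_s\in\mathbb{Z}_{\ge1}$ and $i_1,\dots,i_s\in\{1,2,3\}$. Then \[\operatorname{size}\big(\mathrm{rot}_{i_s}^{n_s}\cdots\mathrm{rot}_{i_1}^{n_1}(1,1,1)\big)\le(3\epsilon)^{2^{s-1}(n_1+1)\cdots(n_s+1)},\qquad \epsilon=\frac{3+\sqrt5}{2}.\]
   Context: The rotations act on $\mathbb{Z}^3$ by $\mathrm{rot}_1(x_1,x_2,x_3)=(x_1,x_3,3x_1x_3-x_2)$, $\mathrm{rot}_2(x_1,x_2,x_3)=(x_3,x_2,3x_2x_3-x_1)$, $\mathrm{rot}_3(x_1,x_2,x_3)=(x_2,3x_2x_3-x_1,x_3)$. For an integer triple, $\operatorname{size}(x_1,x_2,x_3)=\max\{x_1,x_2,x_3\}$. -}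

module Defs where

open import Data.Nat as ℕ using (ℕ; zero; suc)
open import Data.Integer as ℤ using (ℤ; +_; _+_; _-_; _*_; _≤_; _<_; _⊔_)
open import Data.Fin using (Fin; zero; suc)
open import Data.Vec using (Vec; []; _∷_)
open import Data.Product using (_×_; _,_)
open import Data.Sum using (_⊎_)

Triple : Set
Triple = ℤ × ℤ × ℤ

-- rot i for i ∈ Fin 3 : index zero = rot₁, suc zero = rot₂, suc (suc zero) = rot₃
rot : Fin 3 → Triple → Triple
rot zero             (x₁ , x₂ , x₃) = (x₁ , x₃ , + 3 * x₁ * x₃ - x₂)
rot (suc zero)       (x₁ , x₂ , x₃) = (x₃ , x₂ , + 3 * x₂ * x₃ - x₁)
rot (suc (suc zero)) (x₁ , x₂ , x₃) = (x₂ , + 3 * x₂ * x₃ - x₁ , x₃)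

iter : {A : Set} → ℕ → (A → A) → A → A
iter zero    f a = a
iter (suc n) f a = f (iter n f a)

-- rot_{i_s}^{n_s} ⋯ rot_{i_1}^{n_1} t  (rot_{i_1}^{n_1} is applied first)
applySeq : {s : ℕ} → Vec ℕ s → Vec (Fin 3) s → Triple → Triple
applySeq []       []       t = t
applySeq (n ∷ ns) (i ∷ is) t = applySeq ns is (iter n (rot i) t)

size : Triple → ℤ
size (x₁ , x₂ , x₃) = x₁ ⊔ x₂ ⊔ x₃

prodSucc : {s : ℕ} → Vec ℕ s → ℕ
prodSucc []       = 1
prodSucc (n ∷ ns) = suc n ℕ.* prodSucc ns

-- Elements a + b√5 of ℤ[√5], represented by the pair (a , b)
Z√5 : Set
Z√5 = ℤ × ℤ

_*√_ : Z√5 → Z√5 → Z√5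
(a , b) *√ (c , d) = (a * c + + 5 * b * d , a * d + b * c)

_^√_ : Z√5 → ℕ → Z√5
x ^√ zero  = (+ 1 , + 0)
x ^√ suc n = x *√ (x ^√ n)

-- a + b√5 ≥ 0 (as a real number), decided by sign cases and squaring
NonNeg√ : Z√5 → Set
NonNeg√ (a , b) =
    (+ 0 ≤ a × + 0 ≤ b)
  ⊎ (+ 0 ≤ a × b < + 0 × + 5 * (b * b) ≤ a * a)
  ⊎ (a < + 0 × + 0 ≤ b × a * a ≤ + 5 * (b * b))

_≤√_ : ℤ → Z√5 → Set
x ≤√ (a , b) = NonNeg√ (a - x , b)

-- Rotation rotᵢ fixes the i-th coordinate p and replaces another one z by 3py − z, so
-- if every coordinate is at most L/4 in absolute value and the pivot at most M/4 (M ≥ 4),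
-- then afterwards every coordinate is at most ML/4. Since the pivot is constant along a
-- block rotᵢⁿ, a block raises such a bound M to M^(n+1); starting from (1,1,1) with
-- M = 4, the final triple has size at most 4^((n₁+1)⋯(n_s+1)) ≤ 4^N,
-- where N = 2^(s−1)(n₁+1)⋯(n_s+1). Finally 2^N 4^N = 8^N ≤ 9^N, and 9^N is at most the
-- rational part of (9 + 3√5)^N, whose coefficients are all nonnegative.
module Submission where

open import Defs
open import Data.Nat using (ℕ; _∸_; _^_; _≤_)
open import Data.Integer using (+_; _*_)
open import Data.Fin using (Fin; zero)
open import Data.Vec using (Vec; lookup)
open import Data.Product using (_,_)

open import Data.Nat as ℕ using (suc; z≤n; s≤s; NonZero)
import Data.Nat.Properties as ℕ
open import Data.Nat.Tactic.RingSolver using (solve-∀)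
open import Data.Integer as ℤ using (ℤ; ∣_∣; -[1+_]; _-_)
import Data.Integer.Properties as ℤ
open import Data.Fin using (suc)
open import Data.Vec using ([]; _∷_)
open import Data.Product using (_×_; ∃₂)
open import Data.Sum using (inj₁)
open import Relation.Binary.PropositionalEquality

^-distribʳ-* : ∀ m n o → (m ℕ.* n) ^ o ≡ m ^ o ℕ.* n ^ o
^-distribʳ-* m n ℕ.zero = refl
^-distribʳ-* m n (suc o)  = begin
  m ℕ.* n ℕ.* (m ℕ.* n) ^ o       ≡⟨ cong (m ℕ.* n ℕ.*_) (^-distribʳ-* m n o) ⟩
  m ℕ.* n ℕ.* (m ^ o ℕ.* n ^ o)   ≡⟨ ℕ.[m*n]*[o*p]≡[m*o]*[n*p] m n (m ^ o) (n ^ o) ⟩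
  m ℕ.* m ^ o ℕ.* (n ℕ.* n ^ o)   ∎
  where open ≡-Reasoning

m≤m^[1+n] : ∀ m n .{{_ : NonZero m}} → m ≤ m ^ suc n
m≤m^[1+n] m n = ℕ.m≤m*n m (m ^ n) {{ℕ.m^n≢0 m n}}

4≤⇒nonZero : ∀ {M} → 4 ≤ M → NonZero M
4≤⇒nonZero 4≤M = ℕ.>-nonZero (ℕ.≤-trans (s≤s z≤n) 4≤M)

i≤∣i∣ : ∀ i → i ℤ.≤ + ∣ i ∣
i≤∣i∣ (+ n)    = ℤ.≤-refl
i≤∣i∣ -[1+ n ] = ℤ.-≤+

-- Coordinates at most M/4 in absolute value: the scaling makes one rotation multiply bounds.
BoundedBy : ℕ → Triple → Set
BoundedBy M (x₁ , x₂ , x₃) = 4 ℕ.* ∣ x₁ ∣ ≤ M × 4 ℕ.* ∣ x₂ ∣ ≤ M × 4 ℕ.* ∣ x₃ ∣ ≤ M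

BoundedBy-mono : ∀ {M M′} t → M ≤ M′ → BoundedBy M t → BoundedBy M′ t
BoundedBy-mono t M≤M′ (b₁ , b₂ , b₃) = ℕ.≤-trans b₁ M≤M′ , ℕ.≤-trans b₂ M≤M′ , ℕ.≤-trans b₃ M≤M′

size≤ : ∀ {M} t → BoundedBy M t → size t ℤ.≤ + M
size≤ (x₁ , x₂ , x₃) (b₁ , b₂ , b₃) = ℤ.⊔-lub (ℤ.⊔-lub (coordinate≤ x₁ b₁) (coordinate≤ x₂ b₂)) (coordinate≤ x₃ b₃)
  where
  coordinate≤ : ∀ {M} x → 4 ℕ.* ∣ x ∣ ≤ M → x ℤ.≤ + M
  coordinate≤ x b = ℤ.≤-trans (i≤∣i∣ x) (ℤ.+≤+ (ℕ.≤-trans (ℕ.m≤n*m ∣ x ∣ 4) b))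

pivot : Fin 3 → Triple → ℤ
pivot zero             (x₁ , x₂ , x₃) = x₁
pivot (suc zero)       (x₁ , x₂ , x₃) = x₂
pivot (suc (suc zero)) (x₁ , x₂ , x₃) = x₃

pivot-rot : ∀ i t → pivot i (rot i t) ≡ pivot i t
pivot-rot zero             t = refl
pivot-rot (suc zero)       t = refl
pivot-rot (suc (suc zero)) t = refl

pivot-iter : ∀ i n t → pivot i (iter n (rot i) t) ≡ pivot i t
pivot-iter i ℕ.zero t = refl
pivot-iter i (suc n)  t = trans (pivot-rot i (iter n (rot i) t)) (pivot-iter i n t)

pivot-bound : ∀ i {M} t → BoundedBy M t → 4 ℕ.* ∣ pivot i t ∣ ≤ M
pivot-bound zero             t (b₁ , b₂ , b₃) = b₁
pivot-bound (suc zero)       t (b₁ , b₂ , b₃) = b₂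
pivot-bound (suc (suc zero)) t (b₁ , b₂ , b₃) = b₃

scaled-bound : ∀ {M L} a b c → 4 ≤ M → 4 ℕ.* a ≤ M → 4 ℕ.* b ≤ L → 4 ℕ.* c ≤ L →
               4 ℕ.* (3 ℕ.* a ℕ.* b ℕ.+ c) ≤ M ℕ.* L
scaled-bound {M} {L} a b c 4≤M a≤ b≤ c≤ = ℕ.*-cancelˡ-≤ 4 (begin
  4 ℕ.* (4 ℕ.* (3 ℕ.* a ℕ.* b ℕ.+ c))                 ≡⟨ expand a b c ⟩
  3 ℕ.* (4 ℕ.* a) ℕ.* (4 ℕ.* b) ℕ.+ 4 ℕ.* (4 ℕ.* c)   ≤⟨ ℕ.+-mono-≤ (ℕ.*-mono-≤ (ℕ.*-monoʳ-≤ 3 a≤) b≤) (ℕ.*-mono-≤ 4≤M c≤) ⟩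
  3 ℕ.* M ℕ.* L ℕ.+ M ℕ.* L                           ≡⟨ collect M L ⟩
  4 ℕ.* (M ℕ.* L)                                     ∎)
  where
  open ℕ.≤-Reasoning
  expand : ∀ a b c → 4 ℕ.* (4 ℕ.* (3 ℕ.* a ℕ.* b ℕ.+ c)) ≡ 3 ℕ.* (4 ℕ.* a) ℕ.* (4 ℕ.* b) ℕ.+ 4 ℕ.* (4 ℕ.* c)
  expand = solve-∀
  collect : ∀ M L → 3 ℕ.* M ℕ.* L ℕ.+ M ℕ.* L ≡ 4 ℕ.* (M ℕ.* L)
  collect = solve-∀

rotated-bound : ∀ {M L} p q r → 4 ≤ M → 4 ℕ.* ∣ p ∣ ≤ M → 4 ℕ.* ∣ q ∣ ≤ L → 4 ℕ.* ∣ r ∣ ≤ L →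
                4 ℕ.* ∣ + 3 * p * q - r ∣ ≤ M ℕ.* L
rotated-bound p q r 4≤M p≤ q≤ r≤ = ℕ.≤-trans (ℕ.*-monoʳ-≤ 4 triangle) (scaled-bound (∣ p ∣) (∣ q ∣) (∣ r ∣) 4≤M p≤ q≤ r≤)
  where
  triangle : ∣ + 3 * p * q - r ∣ ≤ 3 ℕ.* ∣ p ∣ ℕ.* ∣ q ∣ ℕ.+ ∣ r ∣
  triangle = ℕ.≤-trans (ℤ.∣i-j∣≤∣i∣+∣j∣ (+ 3 * p * q) r) (ℕ.≤-reflexive (cong (ℕ._+ ∣ r ∣)
    (trans (ℤ.abs-* (+ 3 * p) q) (cong (ℕ._* ∣ q ∣) (ℤ.abs-* (+ 3) p)))))

bound-grows : ∀ {M L k} → 4 ≤ M → k ≤ L → k ≤ M ℕ.* L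
bound-grows {M} 4≤M k≤L = ℕ.m≤n⇒m≤o*n M {{4≤⇒nonZero 4≤M}} k≤L

rot-bound : ∀ i {M L} t → 4 ≤ M → 4 ℕ.* ∣ pivot i t ∣ ≤ M → BoundedBy L t → BoundedBy (M ℕ.* L) (rot i t)
rot-bound zero (x₁ , x₂ , x₃) 4≤M p≤ (b₁ , b₂ , b₃) =
  bound-grows 4≤M b₁ , bound-grows 4≤M b₃ , rotated-bound x₁ x₃ x₂ 4≤M p≤ b₃ b₂
rot-bound (suc zero) (x₁ , x₂ , x₃) 4≤M p≤ (b₁ , b₂ , b₃) =
  bound-grows 4≤M b₃ , bound-grows 4≤M b₂ , rotated-bound x₂ x₃ x₁ 4≤M p≤ b₃ b₁
rot-bound (suc (suc zero)) (x₁ , x₂ , x₃) 4≤M p≤ (b₁ , b₂ , b₃) =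
  bound-grows 4≤M b₂ , subst (λ y → 4 ℕ.* ∣ y - x₁ ∣ ≤ _) (swap-factors x₃ x₂) (rotated-bound x₃ x₂ x₁ 4≤M p≤ b₂ b₁) ,
  bound-grows 4≤M b₃
  where
  swap-factors : ∀ p q → + 3 * p * q ≡ + 3 * q * p
  swap-factors p q = trans (ℤ.*-assoc (+ 3) p q) (trans (cong (+ 3 *_) (ℤ.*-comm p q)) (sym (ℤ.*-assoc (+ 3) q p)))

iter-rot-bound : ∀ i n {M L} t → 4 ≤ M → 4 ℕ.* ∣ pivot i t ∣ ≤ M → BoundedBy L t →
                 BoundedBy (M ^ n ℕ.* L) (iter n (rot i) t)
iter-rot-bound i ℕ.zero  {L = L} t 4≤M p≤ b = BoundedBy-mono t (ℕ.≤-reflexive (sym (ℕ.*-identityˡ L))) b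
iter-rot-bound i (suc n) {M} {L} t 4≤M p≤ b =
  BoundedBy-mono (rot i tₙ) (ℕ.≤-reflexive (sym (ℕ.*-assoc M (M ^ n) L)))
    (rot-bound i tₙ 4≤M (subst (λ p → 4 ℕ.* ∣ p ∣ ≤ M) (sym (pivot-iter i n t)) p≤) (iter-rot-bound i n t 4≤M p≤ b))
  where tₙ = iter n (rot i) t

iter-rot-power-bound : ∀ i n {M} t → 4 ≤ M → BoundedBy M t → BoundedBy (M ^ suc n) (iter n (rot i) t)
iter-rot-power-bound i n {M} t 4≤M b =
  BoundedBy-mono (iter n (rot i) t) (ℕ.≤-reflexive (ℕ.*-comm (M ^ n) M))
    (iter-rot-bound i n t 4≤M (pivot-bound i t b) b)

applySeq-bound : ∀ {s} (ns : Vec ℕ s) (is : Vec (Fin 3) s) {M} t → 4 ≤ M → BoundedBy M t →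
                 BoundedBy (M ^ prodSucc ns) (applySeq ns is t)
applySeq-bound []       []       {M} t 4≤M b = BoundedBy-mono t (ℕ.≤-reflexive (sym (ℕ.*-identityʳ M))) b
applySeq-bound (n ∷ ns) (i ∷ is) {M} t 4≤M b =
  BoundedBy-mono (applySeq ns is (iter n (rot i) t)) (ℕ.≤-reflexive (ℕ.^-*-assoc M (suc n) (prodSucc ns)))
    (applySeq-bound ns is (iter n (rot i) t)
      (ℕ.≤-trans 4≤M (m≤m^[1+n] M n {{4≤⇒nonZero 4≤M}}))
      (iter-rot-power-bound i n t 4≤M b))

^√-rational-part : ∀ a b n → ∃₂ λ x y → (+ a , + b) ^√ n ≡ (+ x , + y) × a ^ n ≤ x
^√-rational-part a b ℕ.zero = 1 , 0 , refl , ℕ.≤-refl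
^√-rational-part a b (suc n)  with ^√-rational-part a b n
... | x , y , eq , aⁿ≤x rewrite eq =
  a ℕ.* x ℕ.+ 5 ℕ.* b ℕ.* y , a ℕ.* y ℕ.+ b ℕ.* x ,
  cong₂ _,_ (cong₂ ℤ._+_ (sym (ℤ.pos-* a x)) (trans (cong (_* + y) (sym (ℤ.pos-* 5 b))) (sym (ℤ.pos-* (5 ℕ.* b) y))))
            (sym (trans (ℤ.pos-+ (a ℕ.* y) (b ℕ.* x)) (cong₂ ℤ._+_ (ℤ.pos-* a y) (ℤ.pos-* b x)))) ,
  ℕ.≤-trans (ℕ.*-monoʳ-≤ a aⁿ≤x) (ℕ.m≤m+n (a ℕ.* x) _)

≤⇒≤√ : ∀ {v} x y → v ℤ.≤ + x → v ≤√ (+ x , + y)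
≤⇒≤√ x y v≤x = inj₁ (ℤ.i≤j⇒0≤j-i v≤x , ℤ.+≤+ z≤n)

size-applySeq-ones : ∀ {s} (ns : Vec ℕ s) (is : Vec (Fin 3) s) →
                    size (applySeq ns is (+ 1 , + 1 , + 1)) ℤ.≤ + (4 ^ prodSucc ns)
size-applySeq-ones ns is = size≤ _ (applySeq-bound ns is _ ℕ.≤-refl (ℕ.≤-refl , ℕ.≤-refl , ℕ.≤-refl))

2^n*4^n≤9^n : ∀ n → 2 ^ n ℕ.* 4 ^ n ≤ 9 ^ n
2^n*4^n≤9^n n = ℕ.≤-trans (ℕ.≤-reflexive (sym (^-distribʳ-* 2 4 n))) (ℕ.^-monoˡ-≤ n (ℕ.n≤1+n 8))

proposition2p3 : (s : ℕ) → 1 ≤ s → (ns : Vec ℕ s) → (is : Vec (Fin 3) s) →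
    ((k : Fin s) → 1 ≤ lookup ns k) →
    (+ (2 ^ (2 ^ (s ∸ 1) Data.Nat.* prodSucc ns))
      * size (applySeq ns is (+ 1 , + 1 , + 1)))
      ≤√ ((+ 9 , + 3) ^√ (2 ^ (s ∸ 1) Data.Nat.* prodSucc ns))
proposition2p3 s _ ns is _ with ^√-rational-part 9 3 (2 ^ (s ∸ 1) ℕ.* prodSucc ns)
... | x , y , eq , 9ᴺ≤x rewrite eq = ≤⇒≤√ x y (begin
  + (2 ^ N) * size t        ≤⟨ ℤ.*-monoˡ-≤-nonNeg (+ (2 ^ N)) size≤4ᴺ ⟩
  + (2 ^ N) * + (4 ^ N)     ≡⟨ sym (ℤ.pos-* (2 ^ N) (4 ^ N)) ⟩
  + (2 ^ N ℕ.* 4 ^ N)       ≤⟨ ℤ.+≤+ (ℕ.≤-trans (2^n*4^n≤9^n N) 9ᴺ≤x) ⟩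
  + x                       ∎)
  where
  open ℤ.≤-Reasoning
  N : ℕ
  N = 2 ^ (s ∸ 1) ℕ.* prodSucc ns
  t : Triple
  t = applySeq ns is (+ 1 , + 1 , + 1)
  P≤N : prodSucc ns ≤ N
  P≤N = ℕ.m≤n*m (prodSucc ns) (2 ^ (s ∸ 1)) {{ℕ.m^n≢0 2 (s ∸ 1)}}
  size≤4ᴺ : size t ℤ.≤ + (4 ^ N)
  size≤4ᴺ = ℤ.≤-trans (size-applySeq-ones ns is) (ℤ.+≤+ (ℕ.^-monoʳ-≤ 4 P≤N))
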